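{- Let $0\leq k\leq n$. Among the matroids of rank $k$ on $n$ elements of the form $\mathsf{U}_{0,m}\oplus\mathsf{U}_{k-\ell,n-\ell-m}\oplus\mathsf{U}_{\ell,\ell}$ with $m,\ell\geq0$, there are exactly $k(n-k)+1$ isomorphism classes, and the Tutte polynomials of these $k(n-k)+1$ pairwise non-isomorphic matroids are linearly independent.
   Context: $\mathsf{U}_{r,s}$ is the uniform matroid of rank $r$ on $s$ elements ($\mathsf{U}_{0,0}$ the empty matroid). The Tutte polynomial is $T_{\mathsf{M}}(x,y)=\sum_{S\subseteq E}(x-1)^{\operatorname{rk}E-\operatorname{rk}S}(y-1)^{|S|-\operatorname{rk}S}$. -}

module Defs where

open import Data.Nat as ℕ using (ℕ; zero; suc; _⊓_; _∸_)
open import Data.Integer as ℤ using (ℤ; +_; -_)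
open import Data.Bool using (Bool; true; false)
open import Data.Fin using (Fin)
open import Data.Fin.Subset using (Subset; ∣_∣; ⊤)
open import Data.Vec as Vec using (Vec; []; _∷_)
open import Data.List as List using (List; []; _∷_; _++_; upTo; allFin)
open import Data.Product using (Σ; _×_)
open import Function.Bundles using (_↔_; Inverse)
open import Relation.Binary.PropositionalEquality using (_≡_)

-- Matroids, given by their rank function on subsets of the ground set
-- Fin size (only the rank function is needed for the statement).

record Matroid : Set where
  constructor mkMatroid
  field
    size : ℕ
    rk   : Subset size → ℕ
open Matroid public

U : ℕ → ℕ → Matroid
U r s = mkMatroid s (λ S → ∣ S ∣ ⊓ r)

_⊕_ : Matroid → Matroid → Matroid
M ⊕ N = mkMatroid (size M ℕ.+ size N)
  (λ S → rk M (Vec.take (size M) S) ℕ.+ rk N (Vec.drop (size M) S))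
infixl 6 _⊕_

-- Isomorphism: a bijection of ground sets preserving rank of every subset.
-- The image of S ⊆ E(M) under f is the subset j ↦ S (f⁻¹ j) of E(N).
_≅_ : Matroid → Matroid → Set
M ≅ N = Σ (Fin (size M) ↔ Fin (size N)) λ f →
  (S : Subset (size M)) →
    rk N (Vec.tabulate (λ j → Vec.lookup S (Inverse.from f j))) ≡ rk M S

-- Bivariate integer polynomials, as coefficient functions:
-- p i j = coefficient of x^i y^j.

Poly : Set
Poly = ℕ → ℕ → ℤ

sumℤ : List ℤ → ℤ
sumℤ = List.foldr ℤ._+_ (+ 0)

const : ℤ → Poly
const c zero zero = c
const c _    _    = + 0

X Y : Poly
X (suc zero) zero = + 1
X _ _ = + 0
Y zero (suc zero) = + 1
Y _ _ = + 0

_+P_ : Poly → Poly → Poly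
(p +P q) i j = p i j ℤ.+ q i j

_*P_ : Poly → Poly → Poly
(p *P q) i j =
  sumℤ (List.map (λ a → sumℤ (List.map (λ b → p a b ℤ.* q (i ∸ a) (j ∸ b))
                                        (upTo (suc j))))
                 (upTo (suc i)))

_^P_ : Poly → ℕ → Poly
p ^P zero  = const (+ 1)
p ^P suc e = p *P (p ^P e)

sumP : List Poly → Poly
sumP = List.foldr _+P_ (const (+ 0))

allSubsets : (n : ℕ) → List (Subset n)
allSubsets zero    = [] ∷ []
allSubsets (suc n) = List.map (true ∷_) (allSubsets n) ++ List.map (false ∷_) (allSubsets n)

tutte : Matroid → Poly
tutte M = sumP (List.map term (allSubsets (size M)))
  where
  term : Subset (size M) → Poly
  term S = ((X +P const (- + 1)) ^P (rk M ⊤ ∸ rk M S))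
        *P ((Y +P const (- + 1)) ^P (∣ S ∣ ∸ rk M S))

LinIndep : (N : ℕ) → (Fin N → Poly) → Set
LinIndep N P = (c : Fin N → ℤ) →
  ((i j : ℕ) → sumℤ (List.map (λ t → c t ℤ.* P t i j) (allFin N)) ≡ + 0) →
  (t : Fin N) → c t ≡ + 0

-- The family U_{0,m} ⊕ U_{k-ℓ, n-ℓ-m} ⊕ U_{ℓ,ℓ}, with parameters valid
-- (all uniform matroids well defined: ℓ ≤ k and k - ℓ ≤ n - ℓ - m).

family : (n k m ℓ : ℕ) → Matroid
family n k m ℓ = U 0 m ⊕ U (k ∸ ℓ) (n ∸ ℓ ∸ m) ⊕ U ℓ ℓ

Valid : (n k m ℓ : ℕ) → Set
Valid n k m ℓ = (ℓ ℕ.≤ k) × (m ℕ.+ k ℕ.≤ n)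

-- The Tutte polynomial of U_{0,m} ⊕ U_{r,s} ⊕ U_{ℓ,ℓ} is x^ℓ y^m T(U_{r,s}), and for 0 < r < s
-- the polynomial T(U_{r,s}) has no constant term, no monomial x^a y^b with a, b > 0, and a positive
-- coefficient of x (the beta invariant). So the generic member (m, ℓ) of the family, m < n - k and
-- ℓ < k, has a nonzero coefficient at x^{ℓ+1} y^m, where every other member (m', ℓ') with
-- m'k + ℓ' ≥ mk + ℓ vanishes, while x^k y^{n-k} occurs only in the Tutte polynomial of the degenerate
-- member U_{0,n-k} ⊕ U_{k,k}, to which every member with m = n - k or ℓ = k is isomorphic. This
-- triangularity gives linear independence. Generic members have exactly m loops and ℓ coloops, so
-- they are pairwise non-isomorphic, and not isomorphic to the degenerate one, which has n - k loops.

module Submission where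

open import Defs
open import Data.Nat as ℕ using (ℕ; zero; suc; _≤_; _<_; _*_; _+_; _∸_; _⊓_; z≤n; s≤s; _≤?_; _<?_)
import Data.Nat.Properties as ℕP
open import Data.Nat.Induction using (<-rec)
import Data.Nat.Tactic.RingSolver as ℕSolver
open import Data.Integer as ℤ using (ℤ; +_; -_)
import Data.Integer.Properties as ℤP
import Data.Integer.Tactic.RingSolver as ℤSolver
open import Data.Bool using (Bool; true; false; not)
open import Data.List as List using (List; []; _∷_; upTo; allFin)
open import Data.List.Properties using (map-applyUpTo; map-∘; map-tabulate)
open import Data.Vec as Vec using (Vec; []; _∷_; _++_)
import Data.Vec.Properties as VecP
open import Data.Fin using (Fin; zero; suc; toℕ; fromℕ<)
open import Data.Fin.Properties using (+↔⊎; *↔×; toℕ<n; toℕ-injective; toℕ-fromℕ<; suc-injective)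
open import Data.Fin.Subset using (Subset; ∣_∣; ⊤; ⊥; ∁)
open import Data.Fin.Subset.Properties using (∣p∣≤n; ∣⊤∣≡n; ∣⊥∣≡0; ∣∁p∣≡n∸∣p∣)
open import Data.Product using (Σ; _×_; _,_; proj₁; proj₂)
open import Data.Sum as Sum using (_⊎_; inj₁; inj₂)
open import Data.Sum.Function.Propositional using (_⊎-↔_)
open import Data.Empty using (⊥-elim)
open import Relation.Nullary using (yes; no)
open import Function using (id; _∘_)
open import Function.Bundles using (_↔_; Inverse; Injection)
open import Function.Construct.Identity using (↔-id)
open import Function.Construct.Symmetry using (↔-sym)
open import Function.Construct.Composition using (_↔-∘_)
open import Function.Properties.Inverse using (↔⇒↣)
import Algebra.Properties.CommutativeMonoid.Sum as CMSum
open import Relation.Binary.PropositionalEquality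

open CMSum ℕP.+-0-commutativeMonoid using (sum; sum-permute; sum-cong-≗)

∑ : {A : Set} → List A → (A → ℤ) → ℤ
∑ xs f = sumℤ (List.map f xs)

∑-cong : ∀ {A : Set} (xs : List A) {f g : A → ℤ} → (∀ x → f x ≡ g x) → ∑ xs f ≡ ∑ xs g
∑-cong []       eq = refl
∑-cong (x ∷ xs) eq = cong₂ ℤ._+_ (eq x) (∑-cong xs eq)

∑-zero : ∀ {A : Set} (xs : List A) {f : A → ℤ} → (∀ x → f x ≡ + 0) → ∑ xs f ≡ + 0
∑-zero []       eq = refl
∑-zero (x ∷ xs) eq = cong₂ ℤ._+_ (eq x) (∑-zero xs eq)

∑-map : ∀ {A B : Set} (g : A → B) (xs : List A) (f : B → ℤ) → ∑ (List.map g xs) f ≡ ∑ xs (f ∘ g)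
∑-map g xs f = cong sumℤ (sym (map-∘ xs))

∑-++ : ∀ {A : Set} (xs ys : List A) (f : A → ℤ) → ∑ (xs List.++ ys) f ≡ ∑ xs f ℤ.+ ∑ ys f
∑-++ []       ys f = sym (ℤP.+-identityˡ _)
∑-++ (x ∷ xs) ys f = trans (cong (ℤ._+_ (f x)) (∑-++ xs ys f)) (sym (ℤP.+-assoc (f x) _ _))

∑-upTo-suc : ∀ n (f : ℕ → ℤ) → ∑ (upTo (suc n)) f ≡ f 0 ℤ.+ ∑ (upTo n) (f ∘ suc)
∑-upTo-suc n f = cong (λ xs → f 0 ℤ.+ sumℤ xs)
  (trans (map-applyUpTo suc f n) (sym (map-applyUpTo id (f ∘ suc) n)))

∑-+ : ∀ {A : Set} (xs : List A) (f g : A → ℤ) → ∑ xs (λ x → f x ℤ.+ g x) ≡ ∑ xs f ℤ.+ ∑ xs g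
∑-+ []       f g = refl
∑-+ (x ∷ xs) f g = trans (cong (ℤ._+_ (f x ℤ.+ g x)) (∑-+ xs f g))
                         (interchange (f x) (g x) (∑ xs f) (∑ xs g))
  where
  interchange : ∀ a b c d → (a ℤ.+ b) ℤ.+ (c ℤ.+ d) ≡ (a ℤ.+ c) ℤ.+ (b ℤ.+ d)
  interchange = ℤSolver.solve-∀

∑-*ˡ : ∀ {A : Set} (xs : List A) (c : ℤ) (f : A → ℤ) → ∑ xs (λ x → c ℤ.* f x) ≡ c ℤ.* ∑ xs f
∑-*ˡ []       c f = sym (ℤP.*-zeroʳ c)
∑-*ˡ (x ∷ xs) c f = trans (cong (ℤ._+_ (c ℤ.* f x)) (∑-*ˡ xs c f)) (sym (ℤP.*-distribˡ-+ c (f x) _))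

∑-*ʳ : ∀ {A : Set} (xs : List A) (f : A → ℤ) (c : ℤ) → ∑ xs (λ x → f x ℤ.* c) ≡ ∑ xs f ℤ.* c
∑-*ʳ []       f c = refl
∑-*ʳ (x ∷ xs) f c = trans (cong (ℤ._+_ (f x ℤ.* c)) (∑-*ʳ xs f c)) (sym (ℤP.*-distribʳ-+ c (f x) _))

∑-comm : ∀ {A B : Set} (xs : List A) (ys : List B) (f : A → B → ℤ) →
  ∑ xs (λ x → ∑ ys (f x)) ≡ ∑ ys (λ y → ∑ xs (λ x → f x y))
∑-comm []       ys f = sym (∑-zero ys λ _ → refl)
∑-comm (x ∷ xs) ys f = trans (cong (ℤ._+_ (∑ ys (f x))) (∑-comm xs ys f))
                             (sym (∑-+ ys (f x) (λ y → ∑ xs (λ x′ → f x′ y))))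

-- Polynomials in one variable t are coefficient sequences ℕ → ℤ: _⋆_ is their product and
-- shift m multiplies by t^m.
_⋆_ : (ℕ → ℤ) → (ℕ → ℤ) → ℕ → ℤ
(e ⋆ g) i = ∑ (upTo (suc i)) λ a → e a ℤ.* g (i ∸ a)

⋆-suc : ∀ e g i → (e ⋆ g) (suc i) ≡ e 0 ℤ.* g (suc i) ℤ.+ ((e ∘ suc) ⋆ g) i
⋆-suc e g i = ∑-upTo-suc (suc i) λ a → e a ℤ.* g (suc i ∸ a)

⋆-unitˡ : ∀ e g → (∀ a → e (suc a) ≡ + 0) → ∀ i → (e ⋆ g) i ≡ e 0 ℤ.* g i
⋆-unitˡ e g e0 i =
  trans (∑-upTo-suc i λ a → e a ℤ.* g (i ∸ a))
    (trans (cong (ℤ._+_ (e 0 ℤ.* g i)) (∑-zero (upTo i) λ a → cong (ℤ._* g (i ∸ suc a)) (e0 a)))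
           (ℤP.+-identityʳ _))

⋆-unitʳ : ∀ e g → (∀ a → g (suc a) ≡ + 0) → ∀ i → (e ⋆ g) i ≡ e i ℤ.* g 0
⋆-unitʳ e g g0 zero    = ℤP.+-identityʳ _
⋆-unitʳ e g g0 (suc i) = begin
  (e ⋆ g) (suc i)                        ≡⟨ ⋆-suc e g i ⟩
  e 0 ℤ.* g (suc i) ℤ.+ ((e ∘ suc) ⋆ g) i ≡⟨ cong₂ ℤ._+_ (trans (cong (e 0 ℤ.*_) (g0 i)) (ℤP.*-zeroʳ (e 0)))
                                                         (⋆-unitʳ (e ∘ suc) g g0 i) ⟩
  + 0 ℤ.+ e (suc i) ℤ.* g 0              ≡⟨ ℤP.+-identityˡ _ ⟩
  e (suc i) ℤ.* g 0                      ∎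
  where open ≡-Reasoning

shift : ℕ → (ℕ → ℤ) → ℕ → ℤ
shift zero    e         = e
shift (suc m) e zero    = + 0
shift (suc m) e (suc i) = shift m e i

t-1 : ℕ → ℤ
t-1 zero          = - + 1
t-1 (suc zero)    = + 1
t-1 (suc (suc _)) = + 0

⋆-t-1 : ∀ e i → (t-1 ⋆ e) i ≡ - e i ℤ.+ shift 1 e i
⋆-t-1 e zero    = trans (ℤP.+-identityʳ _) (trans (ℤP.-1*i≡-i (e 0)) (sym (ℤP.+-identityʳ _)))
⋆-t-1 e (suc i) = trans (⋆-suc t-1 e i)
  (cong₂ ℤ._+_ (ℤP.-1*i≡-i (e (suc i))) (trans (⋆-unitˡ (t-1 ∘ suc) e (λ _ → refl) i) (ℤP.*-identityˡ (e i))))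

-- Coefficients of (t - 1)^p, through (t - 1) f = t f - f.
[t-1]^ : ℕ → ℕ → ℤ
[t-1]^ zero    zero    = + 1
[t-1]^ zero    (suc i) = + 0
[t-1]^ (suc p) i       = - [t-1]^ p i ℤ.+ shift 1 ([t-1]^ p) i

inX inY : (ℕ → ℤ) → Poly
inX e i zero    = e i
inX e i (suc j) = + 0
inY e zero    j = e j
inY e (suc i) j = + 0

*P-cong : ∀ {P P′ Q Q′ : Poly} → (∀ a b → P a b ≡ P′ a b) → (∀ a b → Q a b ≡ Q′ a b) →
          ∀ i j → (P *P Q) i j ≡ (P′ *P Q′) i j
*P-cong eqP eqQ i j = ∑-cong (upTo (suc i)) λ a → ∑-cong (upTo (suc j)) λ b →
  cong₂ ℤ._*_ (eqP a b) (eqQ (i ∸ a) (j ∸ b))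

inX-*P : ∀ e Q i j → (inX e *P Q) i j ≡ (e ⋆ (λ a → Q a j)) i
inX-*P e Q i j = ∑-cong (upTo (suc i)) λ a →
  let f = λ b → inX e a b ℤ.* Q (i ∸ a) (j ∸ b) in
  trans (∑-upTo-suc j f) (trans (cong (ℤ._+_ (f 0)) (∑-zero (upTo j) λ _ → refl)) (ℤP.+-identityʳ (f 0)))

inY-*P : ∀ e Q i j → (inY e *P Q) i j ≡ (e ⋆ Q i) j
inY-*P e Q i j =
  let f = λ a → ∑ (upTo (suc j)) λ b → inY e a b ℤ.* Q (i ∸ a) (j ∸ b) in
  trans (∑-upTo-suc i f)
    (trans (cong (ℤ._+_ (f 0)) (∑-zero (upTo i) λ _ → ∑-zero (upTo (suc j)) λ _ → refl)) (ℤP.+-identityʳ (f 0)))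

inX-*P-inY : ∀ e f i j → (inX e *P inY f) i j ≡ e i ℤ.* f j
inX-*P-inY e f i j = trans (inX-*P e (inY f) i j) (⋆-unitʳ e (λ a → inY f a j) (λ _ → refl) i)

X-1 Y-1 : Poly
X-1 = X +P const (- + 1)
Y-1 = Y +P const (- + 1)

X-1^-coeff : ∀ p i j → (X-1 ^P p) i j ≡ inX ([t-1]^ p) i j
X-1^-coeff zero    zero    zero    = refl
X-1^-coeff zero    zero    (suc j) = refl
X-1^-coeff zero    (suc i) zero    = refl
X-1^-coeff zero    (suc i) (suc j) = refl
X-1^-coeff (suc p) i j = trans (*P-cong X-1≡inX (X-1^-coeff p) i j)
                               (trans (inX-*P t-1 (inX ([t-1]^ p)) i j) (product j))
  where
  X-1≡inX : ∀ a b → X-1 a b ≡ inX t-1 a b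
  X-1≡inX zero          zero    = refl
  X-1≡inX (suc zero)    zero    = refl
  X-1≡inX (suc (suc a)) zero    = refl
  X-1≡inX zero          (suc b) = refl
  X-1≡inX (suc zero)    (suc b) = refl
  X-1≡inX (suc (suc a)) (suc b) = refl
  product : ∀ j → (t-1 ⋆ (λ a → inX ([t-1]^ p) a j)) i ≡ inX ([t-1]^ (suc p)) i j
  product zero    = ⋆-t-1 ([t-1]^ p) i
  product (suc j) = trans (⋆-unitʳ t-1 (λ a → inX ([t-1]^ p) a (suc j)) (λ _ → refl) i) (ℤP.*-zeroʳ (t-1 i))

Y-1^-coeff : ∀ p i j → (Y-1 ^P p) i j ≡ inY ([t-1]^ p) i j
Y-1^-coeff zero    zero    zero    = refl
Y-1^-coeff zero    zero    (suc j) = refl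
Y-1^-coeff zero    (suc i) zero    = refl
Y-1^-coeff zero    (suc i) (suc j) = refl
Y-1^-coeff (suc p) i j = trans (*P-cong Y-1≡inY (Y-1^-coeff p) i j)
                               (trans (inY-*P t-1 (inY ([t-1]^ p)) i j) (product i))
  where
  Y-1≡inY : ∀ a b → Y-1 a b ≡ inY t-1 a b
  Y-1≡inY zero    zero          = refl
  Y-1≡inY zero    (suc zero)    = refl
  Y-1≡inY zero    (suc (suc b)) = refl
  Y-1≡inY (suc a) zero          = refl
  Y-1≡inY (suc a) (suc zero)    = refl
  Y-1≡inY (suc a) (suc (suc b)) = refl
  product : ∀ i → (t-1 ⋆ inY ([t-1]^ p) i) j ≡ inY ([t-1]^ (suc p)) i j
  product zero    = ⋆-t-1 ([t-1]^ p) j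
  product (suc i) = trans (⋆-unitʳ t-1 (inY ([t-1]^ p) (suc i)) (λ _ → refl) j) (ℤP.*-zeroʳ (t-1 j))

sumP-coeff : ∀ (ps : List Poly) i j → sumP ps i j ≡ ∑ ps (λ P → P i j)
sumP-coeff []       zero    zero    = refl
sumP-coeff []       zero    (suc j) = refl
sumP-coeff []       (suc i) zero    = refl
sumP-coeff []       (suc i) (suc j) = refl
sumP-coeff (P ∷ ps) i j = cong (ℤ._+_ (P i j)) (sumP-coeff ps i j)

tutte-coeff : ∀ M i j → tutte M i j ≡
  ∑ (allSubsets (size M)) λ S → [t-1]^ (rk M ⊤ ∸ rk M S) i ℤ.* [t-1]^ (∣ S ∣ ∸ rk M S) j
tutte-coeff M i j =
  trans (sumP-coeff (List.map term (allSubsets (size M))) i j)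
  (trans (∑-map term (allSubsets (size M)) (λ P → P i j))
  (∑-cong (allSubsets (size M)) λ S →
    trans (*P-cong (X-1^-coeff (corank S)) (Y-1^-coeff (nullity S)) i j)
          (inX-*P-inY ([t-1]^ (corank S)) ([t-1]^ (nullity S)) i j)))
  where
  corank nullity : Subset (size M) → ℕ
  corank S  = rk M ⊤ ∸ rk M S
  nullity S = ∣ S ∣ ∸ rk M S
  term : Subset (size M) → Poly
  term S = (X-1 ^P corank S) *P (Y-1 ^P nullity S)

∑-allSubsets-suc : ∀ n (f : Subset (suc n) → ℤ) →
  ∑ (allSubsets (suc n)) f ≡ ∑ (allSubsets n) (f ∘ (true ∷_)) ℤ.+ ∑ (allSubsets n) (f ∘ (false ∷_))
∑-allSubsets-suc n f = trans (∑-++ (List.map (true ∷_) (allSubsets n)) (List.map (false ∷_) (allSubsets n)) f)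
  (cong₂ ℤ._+_ (∑-map (true ∷_) (allSubsets n) f) (∑-map (false ∷_) (allSubsets n) f))

∑-allSubsets-++ : ∀ a b (f : Subset (a + b) → ℤ) →
  ∑ (allSubsets (a + b)) f ≡ ∑ (allSubsets a) λ S → ∑ (allSubsets b) λ T → f (S ++ T)
∑-allSubsets-++ zero    b f = sym (ℤP.+-identityʳ _)
∑-allSubsets-++ (suc a) b f = trans (∑-allSubsets-suc (a + b) f)
  (trans (cong₂ ℤ._+_ (∑-allSubsets-++ a b (f ∘ (true ∷_))) (∑-allSubsets-++ a b (f ∘ (false ∷_))))
         (sym (∑-allSubsets-suc a λ S → ∑ (allSubsets b) λ T → f (S ++ T))))

shift-below : ∀ m e {j} → j < m → shift m e j ≡ + 0
shift-below (suc m) e {zero}  _         = refl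
shift-below (suc m) e {suc j} (s≤s j<m) = shift-below m e j<m

shift-above : ∀ m e {j} → m ≤ j → shift m e j ≡ e (j ∸ m)
shift-above zero    e _         = refl
shift-above (suc m) e (s≤s m≤j) = shift-above m e m≤j

shift-[t-1]^-suc : ∀ m q j →
  shift m ([t-1]^ (suc q)) j ℤ.+ shift m ([t-1]^ q) j ≡ shift (suc m) ([t-1]^ q) j
shift-[t-1]^-suc zero    q j       = cancel ([t-1]^ q j) (shift 1 ([t-1]^ q) j)
  where
  cancel : ∀ a b → (- a ℤ.+ b) ℤ.+ a ≡ b
  cancel = ℤSolver.solve-∀
shift-[t-1]^-suc (suc m) q zero    = refl
shift-[t-1]^-suc (suc m) q (suc j) = shift-[t-1]^-suc m q j

-- Binomial theorem in the form t^m = Σ_{S ⊆ [m]} (t - 1)^|S|, and its mirror image.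
∑-[t-1]^-size : ∀ m q j → ∑ (allSubsets m) (λ S → [t-1]^ (∣ S ∣ + q) j) ≡ shift m ([t-1]^ q) j
∑-[t-1]^-size zero    q j = ℤP.+-identityʳ _
∑-[t-1]^-size (suc m) q j = trans (∑-allSubsets-suc m _)
  (trans (cong₂ ℤ._+_
           (trans (∑-cong (allSubsets m) λ S → cong (λ e → [t-1]^ e j) (sym (ℕP.+-suc ∣ S ∣ q)))
                  (∑-[t-1]^-size m (suc q) j))
           (∑-[t-1]^-size m q j))
         (shift-[t-1]^-suc m q j))

∑-[t-1]^-cosize : ∀ ℓ p i → ∑ (allSubsets ℓ) (λ S → [t-1]^ (p + (ℓ ∸ ∣ S ∣)) i) ≡ shift ℓ ([t-1]^ p) i
∑-[t-1]^-cosize zero    p i = trans (ℤP.+-identityʳ _) (cong (λ e → [t-1]^ e i) (ℕP.+-identityʳ p))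
∑-[t-1]^-cosize (suc ℓ) p i = trans (∑-allSubsets-suc ℓ _)
  (trans (cong₂ ℤ._+_
           (∑-[t-1]^-cosize ℓ p i)
           (trans (∑-cong (allSubsets ℓ) λ S → cong (λ e → [t-1]^ e i) (suc-inside S))
                  (∑-[t-1]^-cosize ℓ (suc p) i)))
         (trans (ℤP.+-comm (shift ℓ ([t-1]^ p) i) _) (shift-[t-1]^-suc ℓ p i)))
  where
  suc-inside : (S : Subset ℓ) → p + (suc ℓ ∸ ∣ S ∣) ≡ suc p + (ℓ ∸ ∣ S ∣)
  suc-inside S = trans (cong (_+_ p) (ℕP.+-∸-assoc 1 (∣p∣≤n S))) (ℕP.+-suc p (ℓ ∸ ∣ S ∣))

take-++ : ∀ {A : Set} {a b} (xs : Vec A a) (ys : Vec A b) → Vec.take a (xs ++ ys) ≡ xs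
take-++ []       ys = refl
take-++ (x ∷ xs) ys = cong (x ∷_) (take-++ xs ys)

drop-++ : ∀ {A : Set} {a b} (xs : Vec A a) (ys : Vec A b) → Vec.drop a (xs ++ ys) ≡ ys
drop-++ []       ys = refl
drop-++ (x ∷ xs) ys = drop-++ xs ys

∣++∣ : ∀ {a b} (xs : Subset a) (ys : Subset b) → ∣ xs ++ ys ∣ ≡ ∣ xs ∣ + ∣ ys ∣
∣++∣ []           ys = refl
∣++∣ (true  ∷ xs) ys = cong suc (∣++∣ xs ys)
∣++∣ (false ∷ xs) ys = ∣++∣ xs ys

⊤-++ : ∀ a b → ⊤ {a + b} ≡ ⊤ {a} ++ ⊤ {b}
⊤-++ zero    b = refl
⊤-++ (suc a) b = cong (true ∷_) (⊤-++ a b)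

loops⊕U⊕coloops : ℕ → ℕ → ℕ → ℕ → Matroid
loops⊕U⊕coloops m r s ℓ = U 0 m ⊕ U r s ⊕ U ℓ ℓ

rk-loops⊕U⊕coloops : ∀ m r s ℓ (S₁ : Subset m) (S₂ : Subset s) (S₃ : Subset ℓ) →
  rk (loops⊕U⊕coloops m r s ℓ) ((S₁ ++ S₂) ++ S₃) ≡ ∣ S₂ ∣ ⊓ r + ∣ S₃ ∣
rk-loops⊕U⊕coloops m r s ℓ S₁ S₂ S₃
  rewrite take-++ (S₁ ++ S₂) S₃ | drop-++ (S₁ ++ S₂) S₃ | take-++ S₁ S₂ | drop-++ S₁ S₂
        | ℕP.⊓-zeroʳ ∣ S₁ ∣ | ℕP.m≤n⇒m⊓n≡m (∣p∣≤n S₃) = refl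

rk⊤-loops⊕U⊕coloops : ∀ m r s ℓ → r ≤ s → rk (loops⊕U⊕coloops m r s ℓ) ⊤ ≡ r + ℓ
rk⊤-loops⊕U⊕coloops m r s ℓ r≤s
  rewrite ⊤-++ (m + s) ℓ | ⊤-++ m s | rk-loops⊕U⊕coloops m r s ℓ ⊤ ⊤ ⊤
        | ∣⊤∣≡n s | ∣⊤∣≡n ℓ | ℕP.m≥n⇒m⊓n≡n r≤s = refl

[m+n]∸[o+p]≡[m∸o]+[n∸p] : ∀ {a b c d} → c ≤ a → d ≤ b → (a + b) ∸ (c + d) ≡ (a ∸ c) + (b ∸ d)
[m+n]∸[o+p]≡[m∸o]+[n∸p] {a} {b} {c} {d} c≤a d≤b = trans (sym (ℕP.∸-+-assoc (a + b) c d))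
  (trans (cong (_∸ d) (ℕP.+-∸-comm b c≤a)) (ℕP.+-∸-assoc (a ∸ c) d≤b))

-- Coefficients of x^ℓ y^m T(U_{r,s}), expanded over the subsets of U_{r,s}.
familyTutte : ℕ → ℕ → ℕ → ℕ → Poly
familyTutte m r s ℓ i j = ∑ (allSubsets s) λ S →
  shift ℓ ([t-1]^ (r ∸ ∣ S ∣ ⊓ r)) i ℤ.* shift m ([t-1]^ (∣ S ∣ ∸ ∣ S ∣ ⊓ r)) j

-- For r ≤ s this is T(U_{r,s}); the junk values at r > s are passed through by uniformTutte-rec.
uniformTutte : ℕ → ℕ → Poly
uniformTutte r s = familyTutte 0 r s 0

tutte-loops⊕U⊕coloops : ∀ m r s ℓ → r ≤ s → ∀ i j →
  tutte (loops⊕U⊕coloops m r s ℓ) i j ≡ familyTutte m r s ℓ i j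
tutte-loops⊕U⊕coloops m r s ℓ r≤s i j = begin
  tutte M i j
    ≡⟨ tutte-coeff M i j ⟩
  ∑ (allSubsets ((m + s) + ℓ)) term
    ≡⟨ ∑-allSubsets-++ (m + s) ℓ term ⟩
  ∑ (allSubsets (m + s)) (λ S₁₂ → ∑ (allSubsets ℓ) λ S₃ → term (S₁₂ ++ S₃))
    ≡⟨ ∑-allSubsets-++ m s _ ⟩
  ∑ (allSubsets m) (λ S₁ → ∑ (allSubsets s) λ S₂ → ∑ (allSubsets ℓ) λ S₃ → term ((S₁ ++ S₂) ++ S₃))
    ≡⟨ ∑-cong (allSubsets m) (λ S₁ → ∑-cong (allSubsets s) (sum-over-coloops S₁)) ⟩
  ∑ (allSubsets m) (λ S₁ → ∑ (allSubsets s) λ S₂ → x-part S₂ ℤ.* [t-1]^ (∣ S₁ ∣ + nullity S₂) j)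
    ≡⟨ ∑-comm (allSubsets m) (allSubsets s) _ ⟩
  ∑ (allSubsets s) (λ S₂ → ∑ (allSubsets m) λ S₁ → x-part S₂ ℤ.* [t-1]^ (∣ S₁ ∣ + nullity S₂) j)
    ≡⟨ ∑-cong (allSubsets s) sum-over-loops ⟩
  familyTutte m r s ℓ i j ∎
  where
  open ≡-Reasoning
  M = loops⊕U⊕coloops m r s ℓ
  term : Subset (size M) → ℤ
  term S = [t-1]^ (rk M ⊤ ∸ rk M S) i ℤ.* [t-1]^ (∣ S ∣ ∸ rk M S) j
  corank nullity : Subset s → ℕ
  corank  S = r ∸ ∣ S ∣ ⊓ r
  nullity S = ∣ S ∣ ∸ ∣ S ∣ ⊓ r
  x-part : Subset s → ℤ
  x-part S₂ = shift ℓ ([t-1]^ (corank S₂)) i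

  term-split : ∀ S₁ S₂ S₃ → term ((S₁ ++ S₂) ++ S₃) ≡
    [t-1]^ (corank S₂ + (ℓ ∸ ∣ S₃ ∣)) i ℤ.* [t-1]^ (∣ S₁ ∣ + nullity S₂) j
  term-split S₁ S₂ S₃ = cong₂ (λ a b → [t-1]^ a i ℤ.* [t-1]^ b j) corank-eq nullity-eq
    where
    ∣S₂∣⊓r≤∣S₂∣ = ℕP.m⊓n≤m ∣ S₂ ∣ r
    corank-eq : rk M ⊤ ∸ rk M ((S₁ ++ S₂) ++ S₃) ≡ corank S₂ + (ℓ ∸ ∣ S₃ ∣)
    corank-eq = begin
      rk M ⊤ ∸ rk M ((S₁ ++ S₂) ++ S₃)
        ≡⟨ cong₂ _∸_ (rk⊤-loops⊕U⊕coloops m r s ℓ r≤s) (rk-loops⊕U⊕coloops m r s ℓ S₁ S₂ S₃) ⟩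
      (r + ℓ) ∸ (∣ S₂ ∣ ⊓ r + ∣ S₃ ∣)
        ≡⟨ [m+n]∸[o+p]≡[m∸o]+[n∸p] (ℕP.m⊓n≤n ∣ S₂ ∣ r) (∣p∣≤n S₃) ⟩
      corank S₂ + (ℓ ∸ ∣ S₃ ∣) ∎
    nullity-eq : ∣ (S₁ ++ S₂) ++ S₃ ∣ ∸ rk M ((S₁ ++ S₂) ++ S₃) ≡ ∣ S₁ ∣ + nullity S₂
    nullity-eq = begin
      ∣ (S₁ ++ S₂) ++ S₃ ∣ ∸ rk M ((S₁ ++ S₂) ++ S₃)
        ≡⟨ cong₂ _∸_ (trans (∣++∣ (S₁ ++ S₂) S₃) (cong (_+ ∣ S₃ ∣) (∣++∣ S₁ S₂)))
                     (rk-loops⊕U⊕coloops m r s ℓ S₁ S₂ S₃) ⟩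
      ((∣ S₁ ∣ + ∣ S₂ ∣) + ∣ S₃ ∣) ∸ (∣ S₂ ∣ ⊓ r + ∣ S₃ ∣)
        ≡⟨ [m+n]∸[o+p]≡[m∸o]+[n∸p] (ℕP.≤-trans ∣S₂∣⊓r≤∣S₂∣ (ℕP.m≤n+m ∣ S₂ ∣ ∣ S₁ ∣)) ℕP.≤-refl ⟩
      ((∣ S₁ ∣ + ∣ S₂ ∣) ∸ ∣ S₂ ∣ ⊓ r) + (∣ S₃ ∣ ∸ ∣ S₃ ∣)
        ≡⟨ cong₂ _+_ (ℕP.+-∸-assoc ∣ S₁ ∣ ∣S₂∣⊓r≤∣S₂∣) (ℕP.n∸n≡0 ∣ S₃ ∣) ⟩
      (∣ S₁ ∣ + nullity S₂) + 0
        ≡⟨ ℕP.+-identityʳ _ ⟩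
      ∣ S₁ ∣ + nullity S₂ ∎

  sum-over-coloops : ∀ S₁ S₂ → ∑ (allSubsets ℓ) (λ S₃ → term ((S₁ ++ S₂) ++ S₃)) ≡
                               x-part S₂ ℤ.* [t-1]^ (∣ S₁ ∣ + nullity S₂) j
  sum-over-coloops S₁ S₂ = trans (∑-cong (allSubsets ℓ) (term-split S₁ S₂))
    (trans (∑-*ʳ (allSubsets ℓ) (λ S₃ → [t-1]^ (corank S₂ + (ℓ ∸ ∣ S₃ ∣)) i) _)
           (cong (ℤ._* [t-1]^ (∣ S₁ ∣ + nullity S₂) j) (∑-[t-1]^-cosize ℓ (corank S₂) i)))

  sum-over-loops : ∀ S₂ → ∑ (allSubsets m) (λ S₁ → x-part S₂ ℤ.* [t-1]^ (∣ S₁ ∣ + nullity S₂) j) ≡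
                          x-part S₂ ℤ.* shift m ([t-1]^ (nullity S₂)) j
  sum-over-loops S₂ = trans (∑-*ˡ (allSubsets m) (x-part S₂) _)
                            (cong (x-part S₂ ℤ.*_) (∑-[t-1]^-size m (nullity S₂) j))

familyTutte-below-ℓ : ∀ m r s ℓ {i} j → i < ℓ → familyTutte m r s ℓ i j ≡ + 0
familyTutte-below-ℓ m r s ℓ j i<ℓ = ∑-zero (allSubsets s) λ S →
  cong (ℤ._* shift m ([t-1]^ (∣ S ∣ ∸ ∣ S ∣ ⊓ r)) j) (shift-below ℓ _ i<ℓ)

familyTutte-below-m : ∀ m r s ℓ i {j} → j < m → familyTutte m r s ℓ i j ≡ + 0
familyTutte-below-m m r s ℓ i j<m = ∑-zero (allSubsets s) λ S →
  let a = shift ℓ ([t-1]^ (r ∸ ∣ S ∣ ⊓ r)) i in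
  trans (cong (a ℤ.*_) (shift-below m _ j<m)) (ℤP.*-zeroʳ a)

familyTutte-above : ∀ m r s ℓ {i j} → ℓ ≤ i → m ≤ j →
  familyTutte m r s ℓ i j ≡ uniformTutte r s (i ∸ ℓ) (j ∸ m)
familyTutte-above m r s ℓ ℓ≤i m≤j = ∑-cong (allSubsets s) λ S →
  cong₂ ℤ._*_ (shift-above ℓ _ ℓ≤i) (shift-above m _ m≤j)

-- Deletion–contraction for the last element of U_{r+1,s+1}.
uniformTutte-rec : ∀ r s i j →
  uniformTutte (suc r) (suc s) i j ≡ uniformTutte r s i j ℤ.+ uniformTutte (suc r) s i j
uniformTutte-rec r s i j = ∑-allSubsets-suc s _

uniformTutte-≥ : ∀ r s i j → s ≤ r → uniformTutte r s i j ≡ shift s ([t-1]^ (r ∸ s)) i ℤ.* [t-1]^ 0 j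
uniformTutte-≥ r s i j s≤r = trans (∑-cong (allSubsets s) free)
  (trans (∑-*ʳ (allSubsets s) (λ S → [t-1]^ ((r ∸ s) + (s ∸ ∣ S ∣)) i) ([t-1]^ 0 j))
         (cong (ℤ._* [t-1]^ 0 j) (∑-[t-1]^-cosize s (r ∸ s) i)))
  where
  free : (S : Subset s) → [t-1]^ (r ∸ ∣ S ∣ ⊓ r) i ℤ.* [t-1]^ (∣ S ∣ ∸ ∣ S ∣ ⊓ r) j ≡
                          [t-1]^ ((r ∸ s) + (s ∸ ∣ S ∣)) i ℤ.* [t-1]^ 0 j
  free S rewrite ℕP.m≤n⇒m⊓n≡m (ℕP.≤-trans (∣p∣≤n S) s≤r) | ℕP.n∸n≡0 ∣ S ∣ =
    cong (λ c → [t-1]^ c i ℤ.* [t-1]^ 0 j)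
      (trans (cong (_∸ ∣ S ∣) (sym (ℕP.m∸n+n≡m s≤r))) (ℕP.+-∸-assoc (r ∸ s) (∣p∣≤n S)))

uniformTutte-0 : ∀ s i j → uniformTutte 0 s (suc i) j ≡ + 0
uniformTutte-0 s i j = ∑-zero (allSubsets s) λ S →
  cong (λ c → [t-1]^ (0 ∸ c) (suc i) ℤ.* [t-1]^ (∣ S ∣ ∸ c) j) (ℕP.⊓-zeroʳ ∣ S ∣)

uniformTutte-mixed : ∀ r s i j → uniformTutte r s (suc i) (suc j) ≡ + 0
uniformTutte-mixed r       zero    i j =
  trans (uniformTutte-≥ r 0 (suc i) (suc j) z≤n) (ℤP.*-zeroʳ ([t-1]^ r (suc i)))
uniformTutte-mixed zero    (suc s) i j = uniformTutte-0 (suc s) i (suc j)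
uniformTutte-mixed (suc r) (suc s) i j = trans (uniformTutte-rec r s (suc i) (suc j))
  (cong₂ ℤ._+_ (uniformTutte-mixed r s i j) (uniformTutte-mixed (suc r) s i j))

uniformTutte-00 : ∀ r s → uniformTutte r (suc s) 0 0 ≡ + 0
uniformTutte-00 zero    s       = trans (∑-cong (allSubsets (suc s)) loops) (∑-[t-1]^-size (suc s) 0 0)
  where
  loops : (S : Subset (suc s)) →
          [t-1]^ (0 ∸ ∣ S ∣ ⊓ 0) 0 ℤ.* [t-1]^ (∣ S ∣ ∸ ∣ S ∣ ⊓ 0) 0 ≡ [t-1]^ (∣ S ∣ + 0) 0
  loops S rewrite ℕP.⊓-zeroʳ ∣ S ∣ | ℕP.+-identityʳ ∣ S ∣ = ℤP.*-identityˡ _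
uniformTutte-00 (suc r) zero    = uniformTutte-≥ (suc r) 1 0 0 (s≤s z≤n)
uniformTutte-00 (suc r) (suc s) = trans (uniformTutte-rec r (suc s) 0 0)
  (cong₂ ℤ._+_ (uniformTutte-00 r s) (uniformTutte-00 (suc r) s))

uniformTutte-diag : ∀ k → uniformTutte k k k 0 ≡ + 1
uniformTutte-diag k = trans (uniformTutte-≥ k k k 0 ℕP.≤-refl)
  (trans (cong (ℤ._* + 1) (shift-above k ([t-1]^ (k ∸ k)) ℕP.≤-refl))
         (cong (λ c → [t-1]^ c c ℤ.* + 1) (ℕP.n∸n≡0 k)))

uniformTutte-free-x≥0 : ∀ r → + 0 ℤ.≤ uniformTutte (suc r) (suc r) 1 0
uniformTutte-free-x≥0 r = subst (+ 0 ℤ.≤_) (sym (uniformTutte-≥ (suc r) (suc r) 1 0 ℕP.≤-refl)) (value r)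
  where
  value : ∀ r → + 0 ℤ.≤ shift (suc r) ([t-1]^ (r ∸ r)) 1 ℤ.* + 1
  value zero    = ℤ.+≤+ z≤n
  value (suc r) = ℤ.+≤+ z≤n

uniformTutte-x≥0 : ∀ r s → r ≤ s → + 0 ℤ.≤ uniformTutte r s 1 0
uniformTutte-x≥0 zero    s       _         = ℤP.≤-reflexive (sym (uniformTutte-0 s 0 0))
uniformTutte-x≥0 (suc r) (suc s) (s≤s r≤s) with ℕP.m≤n⇒m<n∨m≡n r≤s
... | inj₁ r<s  = subst (+ 0 ℤ.≤_) (sym (uniformTutte-rec r s 1 0))
                    (ℤP.+-mono-≤ (uniformTutte-x≥0 r s r≤s) (uniformTutte-x≥0 (suc r) s r<s))
... | inj₂ refl = uniformTutte-free-x≥0 r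

-- The coefficient of x is the beta invariant of U_{r,s}, which is connected for 0 < r < s.
uniformTutte-x>0 : ∀ {r s} → 1 ≤ r → r < s → + 0 ℤ.< uniformTutte r s 1 0
uniformTutte-x>0 {suc r} {suc s} _ (s≤s r<s) = positive r s r<s
  where
  positive : ∀ r s → r < s → + 0 ℤ.< uniformTutte (suc r) (suc s) 1 0
  positive r (suc s) (s≤s r≤s) = subst (+ 0 ℤ.<_) (sym (uniformTutte-rec r (suc s) 1 0)) (split r≤s)
    where
    split : r ≤ s → + 0 ℤ.< uniformTutte r (suc s) 1 0 ℤ.+ uniformTutte (suc r) (suc s) 1 0
    split r≤s with ℕP.m≤n⇒m<n∨m≡n r≤s
    split _ | inj₁ r<s  = ℤP.+-mono-≤-< (uniformTutte-x≥0 r (suc s) (ℕP.m≤n⇒m≤1+n r≤s)) (positive r s r<s)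
    split _ | inj₂ refl = diagonal r
      where
      diagonal : ∀ r → + 0 ℤ.< uniformTutte r (suc r) 1 0 ℤ.+ uniformTutte (suc r) (suc r) 1 0
      diagonal zero    = ℤ.+<+ (s≤s z≤n)
      diagonal (suc r) = ℤP.+-mono-<-≤ (positive r (suc r) ℕP.≤-refl) (uniformTutte-free-x≥0 (suc r))

familyTutte-support : ∀ {m r s ℓ i j} → 1 ≤ s → familyTutte m r s ℓ i j ≢ + 0 →
  (i ≡ ℓ × m < j) ⊎ (ℓ < i × j ≡ m)
familyTutte-support {m} {r} {suc s} {ℓ} {i} {j} _ ≢0 with i <? ℓ | j <? m
... | yes i<ℓ | _       = ⊥-elim (≢0 (familyTutte-below-ℓ m r (suc s) ℓ j i<ℓ))
... | no _    | yes j<m = ⊥-elim (≢0 (familyTutte-below-m m r (suc s) ℓ i j<m))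
... | no i≮ℓ  | no j≮m  = classify (i ∸ ℓ) (j ∸ m) refl refl
                            (≢0 ∘ trans (familyTutte-above m r (suc s) ℓ ℓ≤i m≤j))
  where
  ℓ≤i = ℕP.≮⇒≥ i≮ℓ
  m≤j = ℕP.≮⇒≥ j≮m
  positive : ∀ {a b c} → a ∸ b ≡ suc c → b < a
  positive eq = ℕP.m∸n≢0⇒n<m (λ eq₀ → ℕP.1+n≢0 (trans (sym eq) eq₀))
  exact : ∀ {a b} → b ≤ a → a ∸ b ≡ 0 → a ≡ b
  exact b≤a eq = ℕP.≤-antisym (ℕP.m∸n≡0⇒m≤n eq) b≤a
  classify : ∀ d e → i ∸ ℓ ≡ d → j ∸ m ≡ e → uniformTutte r (suc s) d e ≢ + 0 →
             (i ≡ ℓ × m < j) ⊎ (ℓ < i × j ≡ m)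
  classify zero    zero    _  _  ≢0′ = ⊥-elim (≢0′ (uniformTutte-00 r s))
  classify zero    (suc e) eᵢ eⱼ _   = inj₁ (exact ℓ≤i eᵢ , positive eⱼ)
  classify (suc d) zero    eᵢ eⱼ _   = inj₂ (positive eᵢ , exact m≤j eⱼ)
  classify (suc d) (suc e) _  _  ≢0′ = ⊥-elim (≢0′ (uniformTutte-mixed r (suc s) d e))

∑-allFin-single : ∀ {N} (f : Fin N → ℤ) t₀ → (∀ t → t ≢ t₀ → f t ≡ + 0) → ∑ (allFin N) f ≡ f t₀
∑-allFin-single {N} f t₀ others = trans (cong sumℤ (map-tabulate id f)) (single f t₀ others)
  where
  vanish : ∀ {N} (g : Fin N → ℤ) → (∀ t → g t ≡ + 0) → sumℤ (List.tabulate g) ≡ + 0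
  vanish {zero}  g g≡0 = refl
  vanish {suc N} g g≡0 = cong₂ ℤ._+_ (g≡0 zero) (vanish (g ∘ suc) (g≡0 ∘ suc))
  single : ∀ {N} (g : Fin N → ℤ) t₀ → (∀ t → t ≢ t₀ → g t ≡ + 0) → sumℤ (List.tabulate g) ≡ g t₀
  single g zero     others = trans (cong (ℤ._+_ (g zero)) (vanish (g ∘ suc) λ t → others (suc t) λ ()))
                                   (ℤP.+-identityʳ (g zero))
  single g (suc t₀) others = trans (cong (ℤ._+ sumℤ (List.tabulate (g ∘ suc))) (others zero λ ()))
    (trans (ℤP.+-identityˡ _) (single (g ∘ suc) t₀ λ t t≢t₀ → others (suc t) (t≢t₀ ∘ suc-injective)))

LinIndep-triangular : ∀ N (P : Fin N → Poly) (μ : Fin N → ℕ) (wi wj : Fin N → ℕ) →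
  (∀ t → P t (wi t) (wj t) ≢ + 0) →
  (∀ t t′ → P t′ (wi t) (wj t) ≢ + 0 → t′ ≡ t ⊎ μ t′ < μ t) →
  LinIndep N P
LinIndep-triangular N P μ wi wj pivot triangular c comb t = <-rec Goal step (μ t) t refl
  where
  Goal : ℕ → Set
  Goal b = ∀ t → μ t ≡ b → c t ≡ + 0
  step : ∀ b → (∀ {b′} → b′ < b → Goal b′) → Goal b
  step _ smaller t refl with ℤP.i*j≡0⇒i≡0∨j≡0 (c t) (trans (sym (∑-allFin-single _ t others)) (comb (wi t) (wj t)))
    where
    others : ∀ t′ → t′ ≢ t → c t′ ℤ.* P t′ (wi t) (wj t) ≡ + 0
    others t′ t′≢t with P t′ (wi t) (wj t) ℤ.≟ + 0
    ... | yes P≡0 = trans (cong (c t′ ℤ.*_) P≡0) (ℤP.*-zeroʳ (c t′))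
    ... | no  P≢0 with triangular t t′ P≢0
    ...   | inj₁ t′≡t = ⊥-elim (t′≢t t′≡t)
    ...   | inj₂ μ<   = cong (ℤ._* P t′ (wi t) (wj t)) (smaller μ< t′ refl)
  ... | inj₁ c≡0 = c≡0
  ... | inj₂ P≡0 = ⊥-elim (pivot t P≡0)

indicator : Bool → ℕ
indicator true  = 1
indicator false = 0

∣p∣≡sum : ∀ {n} (p : Subset n) → ∣ p ∣ ≡ sum (indicator ∘ Vec.lookup p)
∣p∣≡sum []          = refl
∣p∣≡sum (true  ∷ p) = cong suc (∣p∣≡sum p)
∣p∣≡sum (false ∷ p) = ∣p∣≡sum p

module Image {M N : Matroid} (iso : M ≅ N) where
  private
    f = proj₁ iso

  image : Subset (size M) → Subset (size N)
  image S = Vec.tabulate (Vec.lookup S ∘ Inverse.from f)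

  preimage : Subset (size N) → Subset (size M)
  preimage T = Vec.tabulate (Vec.lookup T ∘ Inverse.to f)

  rk-image : ∀ S → rk N (image S) ≡ rk M S
  rk-image = proj₂ iso

  ∣image∣ : ∀ S → ∣ image S ∣ ≡ ∣ S ∣
  ∣image∣ S = trans (∣p∣≡sum (image S))
    (trans (sum-cong-≗ (cong indicator ∘ VecP.lookup∘tabulate (Vec.lookup S ∘ Inverse.from f)))
      (sym (trans (∣p∣≡sum S) (sum-permute (indicator ∘ Vec.lookup S) (↔-sym f)))))

  image-preimage : ∀ T → image (preimage T) ≡ T
  image-preimage T = trans (VecP.tabulate-cong λ j →
      trans (VecP.lookup∘tabulate (Vec.lookup T ∘ Inverse.to f) (Inverse.from f j))
            (cong (Vec.lookup T) (Inverse.strictlyInverseˡ f j)))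
    (VecP.tabulate∘lookup T)

  image-∁ : ∀ S → image (∁ S) ≡ ∁ (image S)
  image-∁ S = trans (VecP.tabulate-cong λ j → VecP.lookup-map (Inverse.from f j) not S)
                    (VecP.tabulate-∘ not (Vec.lookup S ∘ Inverse.from f))

  image-⊤ : image ⊤ ≡ ⊤
  image-⊤ = trans (VecP.tabulate-cong λ j → trans (VecP.lookup-replicate (Inverse.from f j) true)
                                                  (sym (VecP.lookup-replicate j true)))
                  (VecP.tabulate∘lookup ⊤)

≅-refl : ∀ M → M ≅ M
≅-refl M = ↔-id _ , λ S → cong (rk M) (VecP.tabulate∘lookup S)

≅-sym : ∀ {M N} → M ≅ N → N ≅ M
≅-sym {M} {N} iso = ↔-sym (proj₁ iso) , λ T →
  trans (sym (rk-image (preimage T))) (cong (rk N) (image-preimage T))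
  where open Image {M} {N} iso

-- S is a set of coloops iff deleting it lowers the rank by |S|.
HasLoops HasColoops : Matroid → ℕ → Set
HasLoops   M q = Σ (Subset (size M)) λ S → rk M S ≡ 0 × ∣ S ∣ ≡ q
HasColoops M q = Σ (Subset (size M)) λ S → rk M (∁ S) + ∣ S ∣ ≡ rk M ⊤ × ∣ S ∣ ≡ q

HasLoops-≅ : ∀ {M N q} → M ≅ N → HasLoops M q → HasLoops N q
HasLoops-≅ {M} {N} iso (S , rk≡0 , ∣S∣≡q) =
  image S , trans (rk-image S) rk≡0 , trans (∣image∣ S) ∣S∣≡q
  where open Image {M} {N} iso

HasColoops-≅ : ∀ {M N q} → M ≅ N → HasColoops M q → HasColoops N q
HasColoops-≅ {M} {N} iso (S , drop , ∣S∣≡q) = image S , drop′ , trans (∣image∣ S) ∣S∣≡q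
  where
  open Image {M} {N} iso
  open ≡-Reasoning
  drop′ : rk N (∁ (image S)) + ∣ image S ∣ ≡ rk N ⊤
  drop′ = begin
    rk N (∁ (image S)) + ∣ image S ∣
      ≡⟨ cong₂ _+_ (trans (cong (rk N) (sym (image-∁ S))) (rk-image (∁ S))) (∣image∣ S) ⟩
    rk M (∁ S) + ∣ S ∣ ≡⟨ drop ⟩
    rk M ⊤               ≡⟨ sym (rk-image ⊤) ⟩
    rk N (image ⊤)       ≡⟨ cong (rk N) image-⊤ ⟩
    rk N ⊤ ∎

∀-++ : ∀ {A : Set} {a b} (P : Vec A (a + b) → Set) → (∀ xs ys → P (xs ++ ys)) → ∀ zs → P zs
∀-++ {a = a} P h zs with Vec.splitAt a zs
... | xs , ys , refl = h xs ys

∀-++-++ : ∀ {A : Set} {a b c} (P : Vec A ((a + b) + c) → Set) →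
  (∀ xs ys zs → P ((xs ++ ys) ++ zs)) → ∀ ws → P ws
∀-++-++ {a = a} {b} {c} P h =
  ∀-++ {a = a + b} {c} P λ xys zs → ∀-++ {a = a} {b} (λ xys → P (xys ++ zs)) (λ xs ys → h xs ys zs) xys

∁-++ : ∀ {a b} (xs : Subset a) (ys : Subset b) → ∁ (xs ++ ys) ≡ ∁ xs ++ ∁ ys
∁-++ = VecP.map-++ not

loops⊕U⊕coloops-loops : ∀ m r s ℓ → HasLoops (loops⊕U⊕coloops m r s ℓ) m
loops⊕U⊕coloops-loops m r s ℓ = (⊤ {m} ++ ⊥ {s}) ++ ⊥ {ℓ} , rank , card
  where
  rank : rk (loops⊕U⊕coloops m r s ℓ) ((⊤ {m} ++ ⊥ {s}) ++ ⊥ {ℓ}) ≡ 0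
  rank rewrite rk-loops⊕U⊕coloops m r s ℓ ⊤ ⊥ ⊥ | ∣⊥∣≡0 s | ∣⊥∣≡0 ℓ = refl
  card : ∣ (⊤ {m} ++ ⊥ {s}) ++ ⊥ {ℓ} ∣ ≡ m
  card rewrite ∣++∣ (⊤ {m} ++ ⊥ {s}) (⊥ {ℓ}) | ∣++∣ (⊤ {m}) (⊥ {s}) | ∣⊤∣≡n m | ∣⊥∣≡0 s | ∣⊥∣≡0 ℓ
    = trans (ℕP.+-identityʳ _) (ℕP.+-identityʳ m)

loops⊕U⊕coloops-loops≤ : ∀ m r s ℓ {q} → 1 ≤ r → HasLoops (loops⊕U⊕coloops m r s ℓ) q → q ≤ m
loops⊕U⊕coloops-loops≤ m r s ℓ 1≤r (S , rk≡0 , ∣S∣≡q) =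
  subst (_≤ m) ∣S∣≡q (∀-++-++ {a = m} {s} {ℓ} (λ S → rk M S ≡ 0 → ∣ S ∣ ≤ m) bound S rk≡0)
  where
  M = loops⊕U⊕coloops m r s ℓ
  bound : ∀ S₁ S₂ S₃ → rk M ((S₁ ++ S₂) ++ S₃) ≡ 0 → ∣ (S₁ ++ S₂) ++ S₃ ∣ ≤ m
  bound S₁ S₂ S₃ rk≡0 = subst (_≤ m) (sym card) (∣p∣≤n S₁)
    where
    rank : ∣ S₂ ∣ ⊓ r + ∣ S₃ ∣ ≡ 0
    rank = trans (sym (rk-loops⊕U⊕coloops m r s ℓ S₁ S₂ S₃)) rk≡0
    ∣S₂∣≡0 : ∣ S₂ ∣ ≡ 0
    ∣S₂∣≡0 = ⊓-positive (ℕP.m+n≡0⇒m≡0 _ rank) 1≤r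
      where
      ⊓-positive : ∀ {c r} → c ⊓ r ≡ 0 → 1 ≤ r → c ≡ 0
      ⊓-positive {zero} _ _ = refl
      ⊓-positive {suc c} {suc r} () _
    card : ∣ (S₁ ++ S₂) ++ S₃ ∣ ≡ ∣ S₁ ∣
    card = begin
      ∣ (S₁ ++ S₂) ++ S₃ ∣           ≡⟨ trans (∣++∣ (S₁ ++ S₂) S₃) (cong (_+ ∣ S₃ ∣) (∣++∣ S₁ S₂)) ⟩
      (∣ S₁ ∣ + ∣ S₂ ∣) + ∣ S₃ ∣ ≡⟨ cong₂ (λ a b → (∣ S₁ ∣ + a) + b) ∣S₂∣≡0 (ℕP.m+n≡0⇒n≡0 _ rank) ⟩
      (∣ S₁ ∣ + 0) + 0           ≡⟨ trans (ℕP.+-identityʳ _) (ℕP.+-identityʳ _) ⟩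
      ∣ S₁ ∣ ∎
      where open ≡-Reasoning

loops⊕U⊕coloops-coloops : ∀ m r s ℓ → r ≤ s → HasColoops (loops⊕U⊕coloops m r s ℓ) ℓ
loops⊕U⊕coloops-coloops m r s ℓ r≤s = S , drop , card
  where
  M = loops⊕U⊕coloops m r s ℓ
  S = (⊥ {m} ++ ⊥ {s}) ++ ⊤ {ℓ}
  ∁S : ∁ S ≡ (⊤ {m} ++ ⊤ {s}) ++ ⊥ {ℓ}
  ∁S = trans (∁-++ (⊥ {m} ++ ⊥ {s}) (⊤ {ℓ}))
    (cong₂ _++_ (trans (∁-++ (⊥ {m}) (⊥ {s})) (cong₂ _++_ (∁⊥ m) (∁⊥ s))) (VecP.map-replicate not true ℓ))
    where ∁⊥ = VecP.map-replicate not false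
  card : ∣ S ∣ ≡ ℓ
  card rewrite ∣++∣ (⊥ {m} ++ ⊥ {s}) (⊤ {ℓ}) | ∣++∣ (⊥ {m}) (⊥ {s})
             | ∣⊥∣≡0 m | ∣⊥∣≡0 s | ∣⊤∣≡n ℓ = refl
  drop : rk M (∁ S) + ∣ S ∣ ≡ rk M ⊤
  drop rewrite ∁S | card | rk⊤-loops⊕U⊕coloops m r s ℓ r≤s | rk-loops⊕U⊕coloops m r s ℓ ⊤ ⊤ ⊥
             | ∣⊤∣≡n s | ∣⊥∣≡0 ℓ | ℕP.m≥n⇒m⊓n≡n r≤s | ℕP.+-identityʳ r = refl

-- A nonempty set of elements of U_{r,s}, r < s, is never a set of coloops: deleting it costs
-- more rank than its size.
uniform-coloop-deficit : ∀ {r s c} → r < s → c ≤ s → 1 ≤ c → r < (s ∸ c) ⊓ r + c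
uniform-coloop-deficit {r} {s} {c} r<s c≤s 1≤c with (s ∸ c) ≤? r
... | yes s∸c≤r = subst (r <_) (trans (sym (ℕP.m∸n+n≡m c≤s)) (cong (_+ c) (sym (ℕP.m≤n⇒m⊓n≡m s∸c≤r))))
                        r<s
... | no  s∸c≰r = subst (r <_) (cong (_+ c) (sym (ℕP.m≥n⇒m⊓n≡n (ℕP.<⇒≤ (ℕP.≰⇒> s∸c≰r)))))
                        (ℕP.≤-trans (ℕP.≤-reflexive (ℕP.+-comm 1 r)) (ℕP.+-monoʳ-≤ r 1≤c))

coloop-count : ∀ {r s c₁ c₂} → r < s → c₂ ≤ s → ((s ∸ c₂) ⊓ r + c₂) + c₁ ≡ r → c₁ + c₂ ≡ 0
coloop-count {r} {s} {c₁} {zero}   r<s _   eq = trans (ℕP.+-identityʳ c₁) (ℕP.+-cancelˡ-≡ r _ _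
  (trans (cong (_+ c₁) (sym (trans (ℕP.+-identityʳ _) (ℕP.m≥n⇒m⊓n≡n (ℕP.<⇒≤ r<s)))))
         (trans eq (sym (ℕP.+-identityʳ r)))))
coloop-count {r} {s} {c₁} {suc c₂} r<s c≤s eq = ⊥-elim (ℕP.<⇒≱ (uniform-coloop-deficit r<s c≤s (s≤s z≤n))
  (subst ((s ∸ suc c₂) ⊓ r + suc c₂ ≤_) eq (ℕP.m≤m+n _ c₁)))

loops⊕U⊕coloops-coloops≤ : ∀ m r s ℓ {q} → r < s → HasColoops (loops⊕U⊕coloops m r s ℓ) q → q ≤ ℓ
loops⊕U⊕coloops-coloops≤ m r s ℓ r<s (S , drop , ∣S∣≡q) =
  subst (_≤ ℓ) ∣S∣≡q (∀-++-++ {a = m} {s} {ℓ} (λ S → rk M (∁ S) + ∣ S ∣ ≡ rk M ⊤ → ∣ S ∣ ≤ ℓ) bound S drop)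
  where
  M = loops⊕U⊕coloops m r s ℓ
  bound : ∀ S₁ S₂ S₃ → rk M (∁ ((S₁ ++ S₂) ++ S₃)) + ∣ (S₁ ++ S₂) ++ S₃ ∣ ≡ rk M ⊤ →
          ∣ (S₁ ++ S₂) ++ S₃ ∣ ≤ ℓ
  bound S₁ S₂ S₃ drop = subst (_≤ ℓ) (sym card) (∣p∣≤n S₃)
    where
    open ≡-Reasoning
    c₁ = ∣ S₁ ∣
    c₂ = ∣ S₂ ∣
    c₃ = ∣ S₃ ∣
    card-sum : ∣ (S₁ ++ S₂) ++ S₃ ∣ ≡ (c₁ + c₂) + c₃
    card-sum = trans (∣++∣ (S₁ ++ S₂) S₃) (cong (_+ c₃) (∣++∣ S₁ S₂))
    rank-∁ : rk M (∁ ((S₁ ++ S₂) ++ S₃)) ≡ (s ∸ c₂) ⊓ r + (ℓ ∸ c₃)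
    rank-∁ = begin
      rk M (∁ ((S₁ ++ S₂) ++ S₃))
        ≡⟨ cong (rk M) (trans (∁-++ (S₁ ++ S₂) S₃) (cong (_++ ∁ S₃) (∁-++ S₁ S₂))) ⟩
      rk M ((∁ S₁ ++ ∁ S₂) ++ ∁ S₃)
        ≡⟨ rk-loops⊕U⊕coloops m r s ℓ (∁ S₁) (∁ S₂) (∁ S₃) ⟩
      ∣ ∁ S₂ ∣ ⊓ r + ∣ ∁ S₃ ∣
        ≡⟨ cong₂ (λ a b → a ⊓ r + b) (∣∁p∣≡n∸∣p∣ S₂) (∣∁p∣≡n∸∣p∣ S₃) ⟩
      (s ∸ c₂) ⊓ r + (ℓ ∸ c₃) ∎
    rearrange : ∀ x l a b c → (x + l) + ((a + b) + c) ≡ ((x + b) + a) + (l + c)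
    rearrange = ℕSolver.solve-∀
    remaining : ((s ∸ c₂) ⊓ r + c₂) + c₁ ≡ r
    remaining = ℕP.+-cancelʳ-≡ ℓ _ _ (begin
      (((s ∸ c₂) ⊓ r + c₂) + c₁) + ℓ
        ≡⟨ cong (_+_ (((s ∸ c₂) ⊓ r + c₂) + c₁)) (sym (ℕP.m∸n+n≡m (∣p∣≤n S₃))) ⟩
      (((s ∸ c₂) ⊓ r + c₂) + c₁) + ((ℓ ∸ c₃) + c₃)
        ≡⟨ sym (rearrange ((s ∸ c₂) ⊓ r) (ℓ ∸ c₃) c₁ c₂ c₃) ⟩
      ((s ∸ c₂) ⊓ r + (ℓ ∸ c₃)) + ((c₁ + c₂) + c₃)
        ≡⟨ sym (cong₂ _+_ rank-∁ card-sum) ⟩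
      rk M (∁ ((S₁ ++ S₂) ++ S₃)) + ∣ (S₁ ++ S₂) ++ S₃ ∣
        ≡⟨ drop ⟩
      rk M ⊤
        ≡⟨ rk⊤-loops⊕U⊕coloops m r s ℓ (ℕP.<⇒≤ r<s) ⟩
      r + ℓ ∎)
    card : ∣ (S₁ ++ S₂) ++ S₃ ∣ ≡ c₃
    card = trans card-sum (cong (_+ c₃) (coloop-count r<s (∣p∣≤n S₂) remaining))

countFrom : ∀ {a} → ℕ → Subset a → ℕ
countFrom zero    S       = ∣ S ∣
countFrom (suc c) []      = 0
countFrom (suc c) (_ ∷ S) = countFrom c S

countFrom-cast : ∀ {a b} c (eq : a ≡ b) (S : Subset a) → countFrom c (Vec.cast eq S) ≡ countFrom c S
countFrom-cast c refl S = cong (countFrom c) (VecP.cast-is-id refl S)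

countFrom-++ : ∀ {a b} c (xs : Subset a) (ys : Subset b) → c ≤ a →
  countFrom c (xs ++ ys) ≡ countFrom c xs + ∣ ys ∣
countFrom-++ zero    xs       ys _         = ∣++∣ xs ys
countFrom-++ (suc c) (x ∷ xs) ys (s≤s c≤a) = countFrom-++ c xs ys c≤a

countFrom-length : ∀ {a} (S : Subset a) → countFrom a S ≡ 0
countFrom-length []      = refl
countFrom-length (_ ∷ S) = countFrom-length S

≅-cast : ∀ M N (eq : size M ≡ size N) → (∀ S → rk N (Vec.cast eq S) ≡ rk M S) → M ≅ N
≅-cast (mkMatroid a f) (mkMatroid .a g) refl same-rk = ↔-id _ , λ S →
  trans (cong g (trans (VecP.tabulate∘lookup S) (sym (VecP.cast-is-id refl S)))) (same-rk S)

radix-< : ∀ {k m m′ ℓ ℓ′} → m′ < m → ℓ′ < k → m′ * k + ℓ′ < m * k + ℓ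
radix-< {k} {m} {m′} {ℓ} {ℓ′} m′<m ℓ′<k = ℕP.<-≤-trans (ℕP.+-monoʳ-< (m′ * k) ℓ′<k)
  (ℕP.≤-trans (ℕP.≤-reflexive (ℕP.+-comm (m′ * k) k))
    (ℕP.≤-trans (ℕP.*-monoˡ-≤ k m′<m) (ℕP.m≤m+n (m * k) ℓ)))

module Family (n k : ℕ) (k≤n : k ≤ n) where

  -- The offset x gives both r ≤ s (x = 0) and r < s (x = 1) for U_{r,s} = U_{k-ℓ, n-ℓ-m}.
  rank≤size : ∀ x {m ℓ} → ℓ ≤ k → x + (m + k) ≤ n → x + (k ∸ ℓ) ≤ n ∸ ℓ ∸ m
  rank≤size x {m} {ℓ} ℓ≤k bound rewrite ℕP.∸-+-assoc n ℓ m =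
    ℕP.m+n≤o⇒m≤o∸n (x + (k ∸ ℓ)) (subst (_≤ n) (sym regroup) bound)
    where
    regroup : (x + (k ∸ ℓ)) + (ℓ + m) ≡ x + (m + k)
    regroup = trans (ℕP.+-assoc x (k ∸ ℓ) (ℓ + m))
      (cong (_+_ x) (trans (sym (ℕP.+-assoc (k ∸ ℓ) ℓ m))
                          (trans (cong (_+ m) (ℕP.m∸n+n≡m ℓ≤k)) (ℕP.+-comm k m))))

  m+k≤n : ∀ {m} → m ≤ n ∸ k → m + k ≤ n
  m+k≤n {m} m≤ = subst (m + k ≤_) (ℕP.m∸n+n≡m k≤n) (ℕP.+-monoˡ-≤ k m≤)

  tutte-family : ∀ {m ℓ} → Valid n k m ℓ → ∀ i j →
    tutte (family n k m ℓ) i j ≡ familyTutte m (k ∸ ℓ) (n ∸ ℓ ∸ m) ℓ i j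
  tutte-family {m} {ℓ} (ℓ≤k , m+k≤n) =
    tutte-loops⊕U⊕coloops m (k ∸ ℓ) (n ∸ ℓ ∸ m) ℓ (rank≤size 0 ℓ≤k m+k≤n)

  size-family : ∀ {m ℓ} → Valid n k m ℓ → size (family n k m ℓ) ≡ n
  size-family {m} {ℓ} (ℓ≤k , m+k≤n) = begin
    (m + (n ∸ ℓ ∸ m)) + ℓ   ≡⟨ cong (λ s → (m + s) + ℓ) (ℕP.∸-+-assoc n ℓ m) ⟩
    (m + (n ∸ (ℓ + m))) + ℓ ≡⟨ regroup m (n ∸ (ℓ + m)) ℓ ⟩
    (ℓ + m) + (n ∸ (ℓ + m)) ≡⟨ ℕP.m+[n∸m]≡n ℓ+m≤n ⟩
    n ∎
    where
    open ≡-Reasoning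
    regroup : ∀ a b c → (a + b) + c ≡ (c + a) + b
    regroup = ℕSolver.solve-∀
    ℓ+m≤n : ℓ + m ≤ n
    ℓ+m≤n = ℕP.≤-trans (ℕP.+-monoˡ-≤ m ℓ≤k) (subst (_≤ n) (ℕP.+-comm m k) m+k≤n)

  -- A family member is degenerate when m = n - k or ℓ = k; it is then U_{0,n-k} ⊕ U_{k,k} up to
  -- isomorphism, with rank function S ↦ |S ∩ [n - k, n)|.
  rank-degenerate-m : ∀ {ℓ} → ℓ ≤ k → ∀ S → rk (family n k (n ∸ k) ℓ) S ≡ countFrom (n ∸ k) S
  rank-degenerate-m {ℓ} ℓ≤k = ∀-++-++ {a = n ∸ k} {s} {ℓ} _ λ S₁ S₂ S₃ → begin
    rk (family n k (n ∸ k) ℓ) ((S₁ ++ S₂) ++ S₃)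
      ≡⟨ rk-loops⊕U⊕coloops (n ∸ k) (k ∸ ℓ) s ℓ S₁ S₂ S₃ ⟩
    ∣ S₂ ∣ ⊓ (k ∸ ℓ) + ∣ S₃ ∣
      ≡⟨ cong (_+ ∣ S₃ ∣) (ℕP.m≤n⇒m⊓n≡m (subst (∣ S₂ ∣ ≤_) s≡k∸ℓ (∣p∣≤n S₂))) ⟩
    ∣ S₂ ∣ + ∣ S₃ ∣
      ≡⟨ sym (trans (countFrom-++ (n ∸ k) (S₁ ++ S₂) S₃ (ℕP.m≤m+n (n ∸ k) s))
                    (cong (_+ ∣ S₃ ∣) (trans (countFrom-++ (n ∸ k) S₁ S₂ ℕP.≤-refl)
                                             (cong (_+ ∣ S₂ ∣) (countFrom-length S₁))))) ⟩
    countFrom (n ∸ k) ((S₁ ++ S₂) ++ S₃) ∎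
    where
    open ≡-Reasoning
    s = n ∸ ℓ ∸ (n ∸ k)
    s≡k∸ℓ : s ≡ k ∸ ℓ
    s≡k∸ℓ = trans (ℕP.∸-+-assoc n ℓ (n ∸ k)) (trans (cong (n ∸_) (ℕP.+-comm ℓ (n ∸ k)))
      (trans (sym (ℕP.∸-+-assoc n (n ∸ k) ℓ)) (cong (_∸ ℓ) (ℕP.m∸[m∸n]≡n k≤n))))

  rank-degenerate-ℓ : ∀ {m} → m ≤ n ∸ k → ∀ S → rk (family n k m k) S ≡ countFrom (n ∸ k) S
  rank-degenerate-ℓ {m} m≤ = ∀-++-++ {a = m} {n ∸ k ∸ m} {k} _ λ S₁ S₂ S₃ → begin
    rk (family n k m k) ((S₁ ++ S₂) ++ S₃)
      ≡⟨ rk-loops⊕U⊕coloops m (k ∸ k) (n ∸ k ∸ m) k S₁ S₂ S₃ ⟩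
    ∣ S₂ ∣ ⊓ (k ∸ k) + ∣ S₃ ∣
      ≡⟨ cong (λ r → ∣ S₂ ∣ ⊓ r + ∣ S₃ ∣) (ℕP.n∸n≡0 k) ⟩
    ∣ S₂ ∣ ⊓ 0 + ∣ S₃ ∣
      ≡⟨ cong (_+ ∣ S₃ ∣) (ℕP.⊓-zeroʳ ∣ S₂ ∣) ⟩
    ∣ S₃ ∣
      ≡⟨ sym (trans (cong (λ c → countFrom c ((S₁ ++ S₂) ++ S₃)) (sym (ℕP.m+[n∸m]≡n m≤)))
                    (trans (countFrom-++ (m + (n ∸ k ∸ m)) (S₁ ++ S₂) S₃ ℕP.≤-refl)
                           (cong (_+ ∣ S₃ ∣) (countFrom-length (S₁ ++ S₂))))) ⟩
    countFrom (n ∸ k) ((S₁ ++ S₂) ++ S₃) ∎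
    where open ≡-Reasoning

  degenerate-≅ : ∀ {m ℓ} → Valid n k m ℓ → m ≡ n ∸ k ⊎ ℓ ≡ k → family n k m ℓ ≅ family n k (n ∸ k) 0
  degenerate-≅ {m} {ℓ} valid degenerate = ≅-cast (family n k m ℓ) (family n k (n ∸ k) 0) same-size λ S →
    trans (rank-degenerate-m z≤n (Vec.cast same-size S))
          (trans (countFrom-cast (n ∸ k) same-size S) (sym (rank degenerate S)))
    where
    same-size = trans (size-family valid) (sym (size-family (z≤n , ℕP.≤-reflexive (ℕP.m∸n+n≡m k≤n))))
    rank : m ≡ n ∸ k ⊎ ℓ ≡ k → ∀ S → rk (family n k m ℓ) S ≡ countFrom (n ∸ k) S
    rank (inj₁ refl) = rank-degenerate-m (proj₁ valid)
    rank (inj₂ refl) = rank-degenerate-ℓ (ℕP.m+n≤o⇒m≤o∸n m (proj₂ valid))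

  -- The generic parameters (m, ℓ) ∈ [0, n - k) × [0, k), and one degenerate representative.
  Index : Set
  Index = (Fin k × Fin (n ∸ k)) ⊎ Fin 1

  index↔ : Fin (k * (n ∸ k) + 1) ↔ Index
  index↔ = (*↔× ⊎-↔ ↔-id (Fin 1)) ↔-∘ +↔⊎

  params : Index → ℕ × ℕ
  params (inj₁ (ℓ , m)) = toℕ m , toℕ ℓ
  params (inj₂ _)       = n ∸ k , 0

  M : Index → Matroid
  M a = family n k (proj₁ (params a)) (proj₂ (params a))

  params-valid : ∀ a → Valid n k (proj₁ (params a)) (proj₂ (params a))
  params-valid (inj₁ (ℓ , m)) = ℕP.<⇒≤ (toℕ<n ℓ) , m+k≤n (ℕP.<⇒≤ (toℕ<n m))
  params-valid (inj₂ _)       = z≤n , ℕP.≤-reflexive (ℕP.m∸n+n≡m k≤n)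

  module Generic (ℓ : Fin k) (m : Fin (n ∸ k)) where
    r s : ℕ
    r = k ∸ toℕ ℓ
    s = n ∸ toℕ ℓ ∸ toℕ m

    1≤r : 1 ≤ r
    1≤r = ℕP.m<n⇒0<n∸m (toℕ<n ℓ)

    r<s : r < s
    r<s = rank≤size 1 (ℕP.<⇒≤ (toℕ<n ℓ)) (m+k≤n (toℕ<n m))

    loops≤ : ∀ {q} → HasLoops (M (inj₁ (ℓ , m))) q → q ≤ toℕ m
    loops≤ = loops⊕U⊕coloops-loops≤ (toℕ m) r s (toℕ ℓ) 1≤r

    coloops≤ : ∀ {q} → HasColoops (M (inj₁ (ℓ , m))) q → q ≤ toℕ ℓ
    coloops≤ = loops⊕U⊕coloops-coloops≤ (toℕ m) r s (toℕ ℓ) r<s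

    coloops : HasColoops (M (inj₁ (ℓ , m))) (toℕ ℓ)
    coloops = loops⊕U⊕coloops-coloops (toℕ m) r s (toℕ ℓ) (ℕP.<⇒≤ r<s)

  loops : ∀ a → HasLoops (M a) (proj₁ (params a))
  loops a = loops⊕U⊕coloops-loops _ _ _ _

  M-≅-injective : ∀ a b → M a ≅ M b → a ≡ b
  M-≅-injective a@(inj₁ (ℓ , m)) b@(inj₁ (ℓ′ , m′)) iso = cong inj₁ (cong₂ _,_
    (toℕ-injective (ℕP.≤-antisym (Generic.coloops≤ ℓ′ m′ (HasColoops-≅ {M a} {M b} iso (Generic.coloops ℓ m)))
                                 (Generic.coloops≤ ℓ m (HasColoops-≅ {M b} {M a} iso⁻¹ (Generic.coloops ℓ′ m′)))))
    (toℕ-injective (ℕP.≤-antisym (Generic.loops≤ ℓ′ m′ (HasLoops-≅ {M a} {M b} iso (loops a)))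
                                 (Generic.loops≤ ℓ m (HasLoops-≅ {M b} {M a} iso⁻¹ (loops b))))))
    where iso⁻¹ = ≅-sym {M a} {M b} iso
  M-≅-injective a@(inj₁ (ℓ , m)) b@(inj₂ _) iso =
    ⊥-elim (ℕP.<⇒≱ (toℕ<n m) (Generic.loops≤ ℓ m (HasLoops-≅ {M b} {M a} (≅-sym {M a} {M b} iso) (loops b))))
  M-≅-injective a@(inj₂ _) b@(inj₁ (ℓ , m)) iso =
    ⊥-elim (ℕP.<⇒≱ (toℕ<n m) (Generic.loops≤ ℓ m (HasLoops-≅ {M a} {M b} iso (loops a))))
  M-≅-injective (inj₂ zero) (inj₂ zero) _ = refl

  M-surjective : ∀ m ℓ → Valid n k m ℓ → Σ Index λ a → family n k m ℓ ≅ M a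
  M-surjective m ℓ valid with ℓ <? k | m <? n ∸ k
  ... | yes ℓ<k | yes m<n∸k = inj₁ (fromℕ< ℓ<k , fromℕ< m<n∸k) ,
    subst₂ (λ m′ ℓ′ → family n k m ℓ ≅ family n k m′ ℓ′)
           (sym (toℕ-fromℕ< m<n∸k)) (sym (toℕ-fromℕ< ℓ<k)) (≅-refl _)
  ... | no ℓ≮k | _ = inj₂ zero , degenerate-≅ valid (inj₂ (ℕP.≤-antisym (proj₁ valid) (ℕP.≮⇒≥ ℓ≮k)))
  ... | yes _  | no m≮n∸k = inj₂ zero , degenerate-≅ valid
    (inj₁ (ℕP.≤-antisym (ℕP.m+n≤o⇒m≤o∸n m (proj₂ valid)) (ℕP.≮⇒≥ m≮n∸k)))

  rank pivotX pivotY : Index → ℕ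
  rank (inj₁ (ℓ , m)) = toℕ m * k + toℕ ℓ
  rank (inj₂ _)       = 0
  pivotX (inj₁ (ℓ , m)) = suc (toℕ ℓ)
  pivotX (inj₂ _)       = k
  pivotY (inj₁ (ℓ , m)) = toℕ m
  pivotY (inj₂ _)       = n ∸ k

  T : Index → Poly
  T a = tutte (M a)

  pivot-nonzero : ∀ a → T a (pivotX a) (pivotY a) ≢ + 0
  pivot-nonzero (inj₁ (ℓ , m)) = ℤP.<⇒≢ positive ∘ sym
    where
    open Generic ℓ m
    positive : + 0 ℤ.< T (inj₁ (ℓ , m)) (suc (toℕ ℓ)) (toℕ m)
    positive = subst (+ 0 ℤ.<_)
      (sym (trans (tutte-family (params-valid (inj₁ (ℓ , m))) _ _)
             (trans (familyTutte-above (toℕ m) r s (toℕ ℓ) (ℕP.n≤1+n (toℕ ℓ)) ℕP.≤-refl)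
                    (cong₂ (uniformTutte r s) (ℕP.m+n∸n≡m 1 (toℕ ℓ)) (ℕP.n∸n≡0 (toℕ m))))))
      (uniformTutte-x>0 1≤r r<s)
  pivot-nonzero (inj₂ z) eq with trans (sym degenerate-pivot) eq
    where
    degenerate-pivot : T (inj₂ z) k (n ∸ k) ≡ + 1
    degenerate-pivot = trans (tutte-family (params-valid (inj₂ z)) k (n ∸ k))
      (trans (familyTutte-above (n ∸ k) k (n ∸ 0 ∸ (n ∸ k)) 0 z≤n ℕP.≤-refl)
        (trans (cong₂ (λ s j → uniformTutte k s k j) (ℕP.m∸[m∸n]≡n k≤n) (ℕP.n∸n≡0 (n ∸ k)))
               (uniformTutte-diag k)))
  ... | ()

  pivot-only : ∀ a a′ → T a′ (pivotX a) (pivotY a) ≢ + 0 → a′ ≡ a ⊎ rank a′ < rank a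
  pivot-only (inj₂ zero) (inj₂ zero) _ = inj₁ refl
  pivot-only (inj₂ z) (inj₁ (ℓ′ , m′)) T≢0
    with familyTutte-support (ℕP.≤-trans 1≤r (ℕP.<⇒≤ r<s))
                             (T≢0 ∘ trans (tutte-family (params-valid (inj₁ (ℓ′ , m′))) k (n ∸ k)))
    where open Generic ℓ′ m′
  ... | inj₁ (k≡ℓ′ , _)   = ⊥-elim (ℕP.<-irrefl (sym k≡ℓ′) (toℕ<n ℓ′))
  ... | inj₂ (_ , n∸k≡m′) = ⊥-elim (ℕP.<-irrefl (sym n∸k≡m′) (toℕ<n m′))
  pivot-only (inj₁ (ℓ , m)) (inj₂ z) T≢0 = ⊥-elim (T≢0 (trans (tutte-family (params-valid (inj₂ z)) _ _)
    (familyTutte-below-m (n ∸ k) k (n ∸ 0 ∸ (n ∸ k)) 0 (suc (toℕ ℓ)) (toℕ<n m))))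
  pivot-only (inj₁ (ℓ , m)) (inj₁ (ℓ′ , m′)) T≢0
    with familyTutte-support (ℕP.≤-trans 1≤r (ℕP.<⇒≤ r<s))
                             (T≢0 ∘ trans (tutte-family (params-valid (inj₁ (ℓ′ , m′))) _ _))
    where open Generic ℓ′ m′
  ... | inj₁ (_ , m′<m) = inj₂ (radix-< m′<m (toℕ<n ℓ′))
  ... | inj₂ (ℓ′<1+ℓ , m≡m′) with ℕP.m≤n⇒m<n∨m≡n (ℕ.s≤s⁻¹ ℓ′<1+ℓ)
  ...   | inj₁ ℓ′<ℓ = inj₂ (subst (λ x → x * k + toℕ ℓ′ < toℕ m * k + toℕ ℓ) m≡m′
                                   (ℕP.+-monoʳ-< (toℕ m * k) ℓ′<ℓ))
  ...   | inj₂ ℓ′≡ℓ = inj₁ (cong inj₁ (cong₂ _,_ (toℕ-injective ℓ′≡ℓ) (toℕ-injective (sym m≡m′))))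

proposition4p10 : (n k : ℕ) → k ≤ n →
    Σ (Fin (k * (n ∸ k) + 1) → ℕ × ℕ) λ p →
      let M = λ t → family n k (proj₁ (p t)) (proj₂ (p t)) in
      ((t : Fin (k * (n ∸ k) + 1)) → Valid n k (proj₁ (p t)) (proj₂ (p t)))
      × ((t u : Fin (k * (n ∸ k) + 1)) → M t ≅ M u → t ≡ u)
      × ((m ℓ : ℕ) → Valid n k m ℓ → Σ (Fin (k * (n ∸ k) + 1)) λ t → family n k m ℓ ≅ M t)
      × LinIndep (k * (n ∸ k) + 1) (λ t → tutte (M t))
proposition4p10 n k k≤n =
  params ∘ to , params-valid ∘ to , injective , surjective ,
  LinIndep-triangular _ (T ∘ to) (rank ∘ to) (pivotX ∘ to) (pivotY ∘ to) (pivot-nonzero ∘ to)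
    (λ t t′ T≢0 → Sum.map₁ to-injective (pivot-only (to t) (to t′) T≢0))
  where
  open Family n k k≤n
  open Inverse index↔ using (to; from; strictlyInverseˡ)
  to-injective = Injection.injective (↔⇒↣ index↔)
  injective : ∀ t u → M (to t) ≅ M (to u) → t ≡ u
  injective t u iso = to-injective (M-≅-injective (to t) (to u) iso)
  surjective : ∀ m ℓ → Valid n k m ℓ → Σ (Fin (k * (n ∸ k) + 1)) λ t → family n k m ℓ ≅ M (to t)
  surjective m ℓ valid with M-surjective m ℓ valid
  ... | a , iso = from a , subst (λ b → family n k m ℓ ≅ M b) (sym (strictlyInverseˡ a)) iso
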